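{- Let $N$ be a net, let $P'',P'$ be finite GR-processes of $N$ with $P''\le P'$, and let $\sigma''\in\mathrm{Lin}(P'')$. Then there is $\sigma_0\in\mathrm{Lin}(P')$ with $\sigma''\le\sigma_0$.
   Context: A net is $N=(S,T,F,M_0)$ with $S,T$ disjoint, $F:(S\times T)\cup(T\times S)\to\mathbb{N}$, $M_0:S\to\mathbb{N}$, each transition having finitely many and at least one preplace and finitely many postplaces. ${}^\bullet x(y)=F(y,x)$, $x^\bullet(y)=F(x,y)$ (multisets), extended additively to finite multisets. For markings $M,M'$ and finite non-empty multiset $G$ of transitions, $M\xrightarrow{G}M'$ iff ${}^\bullet G\le M$ and $M'=(M-{}^\bullet G)+G^\bullet$. For a finite or infinite word $\sigma=t_1t_2\cdots$, $M\xrightarrow{\sigma}$ means $M\xrightarrow{\{t_1\}}M_1\xrightarrow{\{t_2\}}\cdots$. $\mathrm{FS}^\infty(N)$: words with $M_0\xrightarrow{\sigma}$; $\mathrm{FS}(N)$: finite ones. $\le$ on words is the prefix order. A GR-process of $N$ is $P=(\mathcal N,\pi)$ where $\mathcal N=(\mathcal S,\mathcal T,\mathcal F,\mathcal M_0)$ is a net such that each place $s$ has $|{}^\bullet s|\le1\ge|s^\bullet|$ and $\mathcal M_0(s)=1$ if ${}^\bullet s=\emptyset$, else $0$; $\mathcal F^+$ (transitive closure of $\{(x,y)\mid\mathcal F(x,y)>0\}$) is irreflexive; each $u\in\mathcal T$ has finitely many $t$ with $(t,u)\in\mathcal F^+$; and $\pi$ maps places to places, transitions to transitions, with $M_0(s)=|\pi^{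 -1}(s)\cap\mathcal M_0|$ and $F(s,\pi(t))=|\pi^{ -1}(s)\cap{}^\bullet t|$, $F(\pi(t),s)=|\pi^{ -1}(s)\cap t^\bullet|$ for all $t\in\mathcal T,s\in S$. Finite means $\mathcal T$ finite. $P'\le P$ (prefix) iff places and transitions of $P'$ are subsets of those of $P$, initial markings coincide, and flow and $\pi$ of $P'$ are the restrictions of those of $P$. $P$ with transitions $\mathcal T$ and $\sigma=t_0t_1\cdots\in\mathrm{FS}^\infty(N)$ are compatible iff there is a bijection $\mathrm{pos}:\mathcal T\to I$ ($I=\{0,\dots,|\sigma|-1\}$ if $\sigma$ finite, $I=\mathbb N$ otherwise) with $\pi(t)=t_{\mathrm{pos}(t)}$ and $(t,t')\in\mathcal F^+\Rightarrow\mathrm{pos}(t)<\mathrm{pos}(t')$. $\mathrm{Lin}(P)$ is the set of firing sequences compatible with $P$. -}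

module Defs where

open import Data.Nat using (ℕ; _≤_; _<_; _∸_; _+_)
open import Data.List using (List; length; lookup; _++_)
open import Data.List.Membership.Propositional using (_∈_)
open import Data.List.Relation.Unary.Unique.Propositional using (Unique)
open import Data.Product using (Σ; _×_; ∃; ∃-syntax)
open import Data.Sum using (_⊎_; inj₁; inj₂)
open import Data.Unit using (⊤)
open import Data.Empty using (⊥)
open import Data.Fin using (Fin; toℕ)
open import Relation.Nullary using (¬_)
open import Relation.Binary.PropositionalEquality using (_≡_)
open import Relation.Binary.Construct.Closure.Transitive using (TransClosure)
open import Function.Bundles using (_↔_; _⇔_)
open import Function.Definitions using (Bijective; Injective)

HasCard : {A : Set} → (A → Set) → ℕ → Set
HasCard {A} P n =
  Σ (List A) λ xs → Unique xs × (∀ a → (a ∈ xs) ⇔ P a) × length xs ≡ n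

-- A net N = (S, T, F, M0).  F is split into its two halves
-- Fst s t = F(s,t) and Fts t s = F(t,s).
record Net : Set₁ where
  field
    S   : Set
    T   : Set
    Fst : S → T → ℕ
    Fts : T → S → ℕ
    M0  : S → ℕ
    pre-nonempty : ∀ t → ∃[ s ] 0 < Fst s t
    pre-finite   : ∀ t → ∃[ xs ] (∀ s → 0 < Fst s t → s ∈ xs)
    post-finite  : ∀ t → ∃[ xs ] (∀ s → 0 < Fts t s → s ∈ xs)

module _ (N : Net) where
  open Net N

  Marking : Set
  Marking = S → ℕ

  Step : Marking → T → Marking → Set
  Step M t M' = (∀ s → Fst s t ≤ M s) × (∀ s → M' s ≡ (M s ∸ Fst s t) + Fts t s)

  Fires : Marking → List T → Set
  Fires M List.[] = ⊤
  Fires M (t List.∷ σ) = Σ Marking λ M' → Step M t M' × Fires M' σ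

  FS : List T → Set
  FS σ = Fires M0 σ

  Arc : S ⊎ T → S ⊎ T → Set
  Arc (inj₁ s) (inj₂ t) = 0 < Fst s t
  Arc (inj₂ t) (inj₁ s) = 0 < Fts t s
  Arc (inj₁ _) (inj₁ _) = ⊥
  Arc (inj₂ _) (inj₂ _) = ⊥

  F⁺ : S ⊎ T → S ⊎ T → Set
  F⁺ = TransClosure Arc

record Process (N : Net) : Set₁ where
  field
    𝒩  : Net
  open Net 𝒩 renaming (S to 𝒮; T to 𝒯; Fst to 𝓕st; Fts to 𝓕ts; M0 to 𝓜0)
  field
    πS : 𝒮 → Net.S N
    πT : 𝒯 → Net.T N
    pre-le1     : ∀ s t → 𝓕ts t s ≤ 1
    pre-unique  : ∀ s t t' → 0 < 𝓕ts t s → 0 < 𝓕ts t' s → t ≡ t'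
    post-le1    : ∀ s t → 𝓕st s t ≤ 1
    post-unique : ∀ s t t' → 0 < 𝓕st s t → 0 < 𝓕st s t' → t ≡ t'
    init-empty    : ∀ s → (∀ t → 𝓕ts t s ≡ 0) → 𝓜0 s ≡ 1
    init-nonempty : ∀ s t → 0 < 𝓕ts t s → 𝓜0 s ≡ 0
    acyclic : ∀ x → ¬ F⁺ 𝒩 x x
    finite-past : ∀ u → ∃[ ts ] (∀ t → F⁺ 𝒩 (inj₂ t) (inj₂ u) → t ∈ ts)
    π-init : ∀ s → HasCard (λ p → πS p ≡ s × 0 < 𝓜0 p) (Net.M0 N s)
    π-pre  : ∀ t s → HasCard (λ p → πS p ≡ s × 0 < 𝓕st p t) (Net.Fst N s (πT t))
    π-post : ∀ t s → HasCard (λ p → πS p ≡ s × 0 < 𝓕ts t p) (Net.Fts N (πT t) s)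

module _ {N : Net} where
  open Process

  FiniteProcess : Process N → Set
  FiniteProcess P = Σ ℕ λ n → Net.T (𝒩 P) ↔ Fin n

  -- P'' ≤ P' : P'' is a prefix of P'.  The subset inclusions of places and
  -- transitions are given by injections ιS, ιT.
  record _≤P_ (P'' P' : Process N) : Set where
    field
      ιS : Net.S (𝒩 P'') → Net.S (𝒩 P')
      ιT : Net.T (𝒩 P'') → Net.T (𝒩 P')
      ιS-inj : Injective _≡_ _≡_ ιS
      ιT-inj : Injective _≡_ _≡_ ιT
      init-eq   : ∀ p → Net.M0 (𝒩 P'') p ≡ Net.M0 (𝒩 P') (ιS p)
      init-incl : ∀ q → 0 < Net.M0 (𝒩 P') q → ∃[ p ] ιS p ≡ q
      Fst-eq : ∀ p t → Net.Fst (𝒩 P'') p t ≡ Net.Fst (𝒩 P') (ιS p) (ιT t)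
      Fts-eq : ∀ t p → Net.Fts (𝒩 P'') t p ≡ Net.Fts (𝒩 P') (ιT t) (ιS p)
      πS-eq  : ∀ p → πS P'' p ≡ πS P' (ιS p)
      πT-eq  : ∀ t → πT P'' t ≡ πT P' (ιT t)

  Compatible : Process N → List (Net.T N) → Set
  Compatible P σ =
    Σ (Net.T (𝒩 P) → Fin (length σ)) λ pos →
      Bijective _≡_ _≡_ pos ×
      (∀ t → πT P t ≡ lookup σ (pos t)) ×
      (∀ t t' → F⁺ (𝒩 P) (inj₂ t) (inj₂ t') → toℕ (pos t) < toℕ (pos t'))

  Lin : Process N → List (Net.T N) → Set
  Lin P σ = FS N σ × Compatible P σ

_⊑_ : {A : Set} → List A → List A → Set
xs ⊑ ys = ∃[ zs ] xs ++ zs ≡ ys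

-- Map σ'' into P' along the prefix embedding and complete it by a topological sort of the
-- remaining transitions of P'. The image is still causally ordered because P'' is closed under
-- causal predecessors in P'. And every causal ordering of all transitions of a process is a
-- linearisation: the marking of N reached along it counts, over each place s of N, the places
-- of the current cut lying over s, so the conditions relating π to F make each step enabled.
module Submission where

open import Defs
open import Data.Nat using (ℕ; zero; suc; _+_; _∸_; _≤_; _<_; s≤s; _<?_)
open import Data.Nat.Properties
  using (≤-antisym; ≮⇒≥; m≤m+n; m+n∸m≡n; ≤-pred; +-suc; <-irrefl; n≤0⇒n≡0; 0<1+n; ≤⇒≯; ≤-reflexive)
open import Data.Fin as Fin using (Fin; toℕ; cast)
import Data.Fin.Properties as Finₚ
open import Data.List using (List; []; _∷_; _++_; _ʳ++_; length; lookup; filter; map; allFin; tabulate)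
open import Data.List.Properties
  using (length-map; length-tabulate; length-++; map-++; map-tabulate; tabulate-cong; tabulate-lookup)
open import Data.List.Relation.Unary.All as All using (All)
open import Data.List.Relation.Unary.Any using (Any; here; there; index; any?; satisfied)
open import Data.List.Relation.Unary.Any.Properties using (lookup-index; reverseAcc⁻)
open import Data.List.Relation.Unary.Unique.Propositional using (Unique; _∷_)
import Data.List.Relation.Unary.Unique.Propositional.Properties as Unique
open import Data.List.Membership.Propositional using (_∈_; _∉_; lose)
open import Data.List.Membership.Propositional.Properties
  using (∉[]; ∈-lookup; ∈-map⁻; ∈-filter⁺; ∈-filter⁻; ∈-++⁺ˡ; ∈-++⁺ʳ; ∈-++⁻; ∈-map⁺; ∈-allFin)
open import Data.List.Relation.Binary.Subset.Propositional using (_⊆_)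
open import Data.Product using (_×_; _,_; proj₁; proj₂; ∃₂; ∃-syntax)
open import Data.Sum using (_⊎_; inj₁; inj₂)
import Data.Sum as Sum
open import Function using (_∘_)
open import Data.Empty using (⊥-elim)
open import Data.Unit using (⊤; tt)
open import Relation.Binary.Construct.Closure.Transitive using ([_]; _∷_) renaming (_++_ to _⁺++_)
open import Function.Bundles using (_⇔_; mk⇔; Equivalence; _↔_; Inverse)
open import Relation.Nullary using (¬_; Dec; yes; no)
open import Relation.Nullary.Decidable using (_×-dec_)
open import Relation.Unary using (Decidable)
open import Relation.Unary.Properties using (∁?)
open import Relation.Binary.Definitions using (DecidableEquality)
open import Relation.Binary.PropositionalEquality
  using (_≡_; _≢_; refl; sym; trans; cong; cong₂; subst; subst₂; module ≡-Reasoning)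
import Relation.Nullary.Decidable as Dec
open import Function.Properties.Inverse using (↔⇒↣)

module _ {A : Set} where

  Unique⇒lookup-injective : {xs : List A} → Unique xs →
                            ∀ i j → lookup xs i ≡ lookup xs j → i ≡ j
  Unique⇒lookup-injective (_ ∷ _) Fin.zero Fin.zero _ = refl
  Unique⇒lookup-injective (x∉ ∷ _) Fin.zero (Fin.suc j) eq =
    ⊥-elim (All.lookup x∉ (∈-lookup j) eq)
  Unique⇒lookup-injective (x∉ ∷ _) (Fin.suc i) Fin.zero eq =
    ⊥-elim (All.lookup x∉ (∈-lookup i) (sym eq))
  Unique⇒lookup-injective (_ ∷ u) (Fin.suc i) (Fin.suc j) eq =
    cong Fin.suc (Unique⇒lookup-injective u i j eq)

  ⊆⇒lookup-collision : {xs ys : List A} → xs ⊆ ys → length ys < length xs →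
                       ∃₂ λ i j → i Fin.< j × lookup xs i ≡ lookup xs j
  ⊆⇒lookup-collision {xs} {ys} xs⊆ys shorter
    with i , j , i<j , same ← Finₚ.pigeonhole shorter (λ i → index (xs⊆ys (∈-lookup i)))
    = i , j , i<j , (begin
        lookup xs i                           ≡⟨ lookup-index (xs⊆ys (∈-lookup i)) ⟩
        lookup ys (index (xs⊆ys (∈-lookup i))) ≡⟨ cong (lookup ys) same ⟩
        lookup ys (index (xs⊆ys (∈-lookup j))) ≡⟨ lookup-index (xs⊆ys (∈-lookup j)) ⟨
        lookup xs j                           ∎)
    where open ≡-Reasoning

  Unique∧⊆⇒length≤ : {xs ys : List A} → Unique xs → xs ⊆ ys → length xs ≤ length ys
  Unique∧⊆⇒length≤ u xs⊆ys = ≮⇒≥ λ shorter →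
    let i , j , i<j , same = ⊆⇒lookup-collision xs⊆ys shorter
    in Finₚ.<-irrefl (Unique⇒lookup-injective u i j same) i<j

  Unique∧⊆∧length≥⇒⊇ : {xs ys : List A} → Unique xs → xs ⊆ ys → length ys ≤ length xs → ys ⊆ xs
  Unique∧⊆∧length≥⇒⊇ {xs} u xs⊆ys ys≤xs {y} y∈ys
    with ⊆⇒lookup-collision {xs = y ∷ xs} y∷xs⊆ys (s≤s ys≤xs)
    where
    y∷xs⊆ys : y ∷ xs ⊆ _
    y∷xs⊆ys (here refl) = y∈ys
    y∷xs⊆ys (there x∈xs) = xs⊆ys x∈xs
  ... | Fin.zero , Fin.suc j , _ , y≡xⱼ = subst (_∈ xs) (sym y≡xⱼ) (∈-lookup j)
  ... | Fin.suc i , Fin.suc j , i<j , same =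
    ⊥-elim (Finₚ.<-irrefl (Unique⇒lookup-injective u i j same) (≤-pred i<j))

  ∉⇒Unique-∷ : ∀ {x} {xs : List A} → x ∉ xs → Unique xs → Unique (x ∷ xs)
  ∉⇒Unique-∷ {xs = xs} x∉ u = All.tabulate (λ y∈ x≡y → x∉ (subst (_∈ xs) (sym x≡y) y∈)) ∷ u

  lookup-map : ∀ {B : Set} (f : A → B) xs i →
               lookup (map f xs) (cast (sym (length-map f xs)) i) ≡ f (lookup xs i)
  lookup-map f (x ∷ xs) Fin.zero = refl
  lookup-map f (x ∷ xs) (Fin.suc i) = lookup-map f xs i

  module _ {P : A → Set} (P? : Decidable P) where

    length-filter-∁ : ∀ xs → length (filter P? xs) + length (filter (∁? P?) xs) ≡ length xs
    length-filter-∁ [] = refl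
    length-filter-∁ (x ∷ xs) with P? x
    ... | yes _ = cong suc (length-filter-∁ xs)
    ... | no _ = trans (+-suc _ _) (cong suc (length-filter-∁ xs))

  module _ {P Q : A → Set} where

    HasCard-cong : ∀ {n} → (∀ a → P a ⇔ Q a) → HasCard P n → HasCard Q n
    HasCard-cong P⇔Q (xs , u , ∈⇔P , len) =
      xs , u , (λ a → mk⇔ (Equivalence.to (P⇔Q a) ∘ Equivalence.to (∈⇔P a))
                          (Equivalence.from (∈⇔P a) ∘ Equivalence.from (P⇔Q a))) , len

    HasCard-⊎ : ∀ {m n} → HasCard P m → HasCard Q n → (∀ a → P a → ¬ Q a) →
                HasCard (λ a → P a ⊎ Q a) (m + n)
    HasCard-⊎ (xs , u , ∈⇔P , refl) (ys , v , ∈⇔Q , refl) disjoint =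
      xs ++ ys ,
      Unique.++⁺ u v (λ (a∈xs , a∈ys) →
                        disjoint _ (Equivalence.to (∈⇔P _) a∈xs) (Equivalence.to (∈⇔Q _) a∈ys)) ,
      (λ a → mk⇔ (λ a∈ → Sum.map (Equivalence.to (∈⇔P a)) (Equivalence.to (∈⇔Q a)) (∈-++⁻ xs a∈))
                 (Sum.[ ∈-++⁺ˡ ∘ Equivalence.from (∈⇔P a) , ∈-++⁺ʳ xs ∘ Equivalence.from (∈⇔Q a) ])) ,
      length-++ xs

  HasCard-unique : ∀ {P : A → Set} {m n} → HasCard P m → HasCard P n → m ≡ n
  HasCard-unique (xs , u , ∈⇔xs , refl) (ys , v , ∈⇔ys , refl) =
    ≤-antisym (Unique∧⊆⇒length≤ u xs⊆ys) (Unique∧⊆⇒length≤ v ys⊆xs)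
    where
    xs⊆ys : xs ⊆ ys
    xs⊆ys {a} = Equivalence.from (∈⇔ys a) ∘ Equivalence.to (∈⇔xs a)
    ys⊆xs : ys ⊆ xs
    ys⊆xs {a} = Equivalence.from (∈⇔xs a) ∘ Equivalence.to (∈⇔ys a)

  HasCard-∖ : ∀ {P Q : A → Set} {n k} → Decidable Q → HasCard P n →
              HasCard (λ a → P a × Q a) k → k ≤ n × HasCard (λ a → P a × ¬ Q a) (n ∸ k)
  HasCard-∖ {P} {Q} {k = k} Q? (xs , u , ∈⇔P , refl) P∩Q =
    subst (_≤ length xs) k≡ (subst (length (filter Q? xs) ≤_) (length-filter-∁ Q? xs) (m≤m+n _ _)) ,
    filter (∁? Q?) xs , Unique.filter⁺ (∁? Q?) u , restrict (∁? Q?) ,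
    (begin
      length (filter (∁? Q?) xs)                                   ≡⟨ m+n∸m≡n (length (filter Q? xs)) _ ⟨
      length (filter Q? xs) + length (filter (∁? Q?) xs) ∸ length (filter Q? xs)
                                                                   ≡⟨ cong₂ _∸_ (length-filter-∁ Q? xs) k≡ ⟩
      length xs ∸ k                                                ∎)
    where
    open ≡-Reasoning
    restrict : ∀ {R : A → Set} (R? : Decidable R) a → (a ∈ filter R? xs) ⇔ (P a × R a)
    restrict R? a = mk⇔ (λ a∈ → let a∈xs , Ra = ∈-filter⁻ R? a∈ in Equivalence.to (∈⇔P a) a∈xs , Ra)
                        (λ (Pa , Ra) → ∈-filter⁺ R? (Equivalence.from (∈⇔P a) Pa) Ra)
    k≡ : length (filter Q? xs) ≡ k
    k≡ = HasCard-unique (filter Q? xs , Unique.filter⁺ Q? u , restrict Q? , refl) P∩Q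

HasCard-injection-onto : ∀ {A B : Set} {P : A → Set} {Q : B → Set} {n} (f : A → B) →
                         (∀ {a a′} → f a ≡ f a′ → a ≡ a′) → (∀ a → P a → Q (f a)) →
                         HasCard P n → HasCard Q n → ∀ b → Q b → ∃[ a ] (P a × f a ≡ b)
HasCard-injection-onto {P = P} f f-injective P⇒Q (xs , u , ∈⇔P , refl) (ys , _ , ∈⇔Q , |ys|≡|xs|) b Qb
  = preimage (∈-map⁻ f (image-covers (Equivalence.from (∈⇔Q b) Qb)))
  where
  preimage : ∃[ a ] (a ∈ xs × b ≡ f a) → ∃[ a ] (P a × f a ≡ b)
  preimage (a , a∈xs , b≡fa) = a , Equivalence.to (∈⇔P a) a∈xs , sym b≡fa
  image⊆ys : map f xs ⊆ ys
  image⊆ys fa∈ with a , a∈xs , refl ← ∈-map⁻ f fa∈ =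
    Equivalence.from (∈⇔Q (f a)) (P⇒Q a (Equivalence.to (∈⇔P a) a∈xs))
  same-length : length ys ≤ length (map f xs)
  same-length = ≤-reflexive (trans |ys|≡|xs| (sym (length-map f xs)))
  image-covers : ys ⊆ map f xs
  image-covers = Unique∧⊆∧length≥⇒⊇ (Unique.map⁺ f-injective u) image⊆ys same-length

module Enumeration {A : Set} {n : ℕ} (A↔Fin : A ↔ Fin n) where
  open Inverse A↔Fin

  elements : List A
  elements = map from (allFin n)

  ∈-elements : ∀ a → a ∈ elements
  ∈-elements a = subst (_∈ elements) (strictlyInverseʳ a) (∈-map⁺ from (∈-allFin (to a)))

  Unique⇒length≤ : {xs : List A} → Unique xs → length xs ≤ n
  Unique⇒length≤ {xs} u = subst (length xs ≤_) length-elements (Unique∧⊆⇒length≤ u (λ {a} _ → ∈-elements a))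
    where
    length-elements : length elements ≡ n
    length-elements = trans (length-map from (allFin n)) (length-tabulate (λ i → i))

  _≟_ : DecidableEquality A
  _≟_ = Dec.via-injection (↔⇒↣ A↔Fin) Finₚ._≟_

  open import Data.List.Membership.DecPropositional _≟_ public using (_∈?_; _∉?_)

  all-or-missing : (xs : List A) → (∀ a → a ∈ xs) ⊎ ∃[ a ] a ∉ xs
  all-or-missing xs with any? (_∉? xs) elements
  ... | yes missing = inj₂ (satisfied missing)
  ... | no none = inj₁ λ a → Dec.decidable-stable (a ∈? xs) (λ a∉xs → none (lose (∈-elements a) a∉xs))

module Causality {N : Net} (P : Process N) where
  open Process P
  open Net 𝒩 renaming (S to 𝒮; T to 𝒯; Fst to 𝓕st; Fts to 𝓕ts; M0 to 𝓜0)

  _≺_ : 𝒯 → 𝒯 → Set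
  t ≺ u = F⁺ 𝒩 (inj₂ t) (inj₂ u)

  _⇀_ : 𝒯 → 𝒯 → Set
  t ⇀ u = ∃[ p ] (0 < 𝓕ts t p × 0 < 𝓕st p u)

  ⇀⇒≺ : ∀ {t u} → t ⇀ u → t ≺ u
  ⇀⇒≺ (p , t→p , p→u) = _∷_ {y = inj₁ p} t→p [ p→u ]

  PastIn : List 𝒯 → 𝒯 → Set
  PastIn done u = ∀ t → t ≺ u → t ∈ done

  Closed : List 𝒯 → Set
  Closed done = ∀ u → u ∈ done → PastIn done u

  Closed-∷ : ∀ {done y} → Closed done → PastIn done y → Closed (y ∷ done)
  Closed-∷ closed past u (here refl) t t≺u = there (past t t≺u)
  Closed-∷ closed past u (there u∈) t t≺u = there (closed u u∈ t t≺u)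

  -- done lists the transitions that occurred before ys, latest first.
  CausallyOrdered : List 𝒯 → List 𝒯 → Set
  CausallyOrdered done [] = ⊤
  CausallyOrdered done (y ∷ ys) = y ∉ done × PastIn done y × CausallyOrdered (y ∷ done) ys

  CausallyOrdered-++ : ∀ {done} xs {ys} → CausallyOrdered done xs →
                       CausallyOrdered (xs ʳ++ done) ys → CausallyOrdered done (xs ++ ys)
  CausallyOrdered-++ [] _ ord = ord
  CausallyOrdered-++ (x ∷ xs) (x∉ , past , ord) ord′ = x∉ , past , CausallyOrdered-++ xs ord ord′

  CausallyOrdered⇒Closed : ∀ {done} xs → Closed done → CausallyOrdered done xs → Closed (xs ʳ++ done)
  CausallyOrdered⇒Closed [] closed _ = closed
  CausallyOrdered⇒Closed (x ∷ xs) closed (_ , past , ord) =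
    CausallyOrdered⇒Closed xs (Closed-∷ closed past) ord

  CausallyOrdered⇒Unique-ʳ++ : ∀ {done} xs → Unique done → CausallyOrdered done xs → Unique (xs ʳ++ done)
  CausallyOrdered⇒Unique-ʳ++ [] u _ = u
  CausallyOrdered⇒Unique-ʳ++ (x ∷ xs) u (x∉ , _ , ord) = CausallyOrdered⇒Unique-ʳ++ xs (∉⇒Unique-∷ x∉ u) ord

  CausallyOrdered⇒fresh : ∀ {done} xs → CausallyOrdered done xs → All (_∉ done) xs
  CausallyOrdered⇒fresh [] _ = All.[]
  CausallyOrdered⇒fresh (x ∷ xs) (x∉ , _ , ord) =
    x∉ All.∷ All.map (λ x∉x∷done → x∉x∷done ∘ there) (CausallyOrdered⇒fresh xs ord)

  CausallyOrdered⇒Unique : ∀ {done} xs → CausallyOrdered done xs → Unique xs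
  CausallyOrdered⇒Unique [] _ = Unique.[]
  CausallyOrdered⇒Unique (x ∷ xs) (_ , _ , ord) =
    All.map (λ y∉ x≡y → y∉ (here (sym x≡y))) (CausallyOrdered⇒fresh xs ord) ∷ CausallyOrdered⇒Unique xs ord

  CausallyOrdered-lookup : ∀ {done} xs → CausallyOrdered done xs → ∀ i t → t ≺ lookup xs i →
                           t ∈ done ⊎ ∃[ j ] (j Fin.< i × lookup xs j ≡ t)
  CausallyOrdered-lookup (x ∷ xs) (_ , past , _) Fin.zero t t≺x = inj₁ (past t t≺x)
  CausallyOrdered-lookup (x ∷ xs) (_ , _ , ord) (Fin.suc i) t t≺xᵢ
    with CausallyOrdered-lookup xs ord i t t≺xᵢ
  ... | inj₁ (here t≡x) = inj₂ (Fin.zero , s≤s _≤_.z≤n , sym t≡x)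
  ... | inj₁ (there t∈done) = inj₁ t∈done
  ... | inj₂ (j , j<i , xⱼ≡t) = inj₂ (Fin.suc j , s≤s j<i , xⱼ≡t)

  tabulate-CausallyOrdered : ∀ {done L} (g : Fin L → 𝒯) → (∀ {i j} → g i ≡ g j → i ≡ j) →
                             (∀ i → g i ∉ done) →
                             (∀ i t → t ≺ g i → t ∈ done ⊎ ∃[ j ] (j Fin.< i × g j ≡ t)) →
                             CausallyOrdered done (tabulate g)
  tabulate-CausallyOrdered {L = zero} _ _ _ _ = tt
  tabulate-CausallyOrdered {done} {suc L} g g-injective fresh before =
    fresh Fin.zero , past₀ ,
    tabulate-CausallyOrdered (g ∘ Fin.suc) (Finₚ.suc-injective ∘ g-injective) fresh′ before′
    where
    past₀ : PastIn done (g Fin.zero)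
    past₀ t t≺g₀ with before Fin.zero t t≺g₀
    ... | inj₁ t∈done = t∈done
    ... | inj₂ (_ , () , _)
    fresh′ : ∀ i → g (Fin.suc i) ∉ g Fin.zero ∷ done
    fresh′ i (here gᵢ₊₁≡g₀) with () ← g-injective gᵢ₊₁≡g₀
    fresh′ i (there gᵢ₊₁∈done) = fresh (Fin.suc i) gᵢ₊₁∈done
    before′ : ∀ i t → t ≺ g (Fin.suc i) → t ∈ g Fin.zero ∷ done ⊎ ∃[ j ] (j Fin.< i × g (Fin.suc j) ≡ t)
    before′ i t t≺gᵢ₊₁ with before (Fin.suc i) t t≺gᵢ₊₁
    ... | inj₁ t∈done = inj₁ (there t∈done)
    ... | inj₂ (Fin.zero , _ , g₀≡t) = inj₁ (here (sym g₀≡t))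
    ... | inj₂ (Fin.suc j , s≤s j<i , gⱼ₊₁≡t) = inj₂ (j , j<i , gⱼ₊₁≡t)

  -- "Every producer of p has fired" agrees with "p is initial or some producer has fired"
  -- by init-empty and init-nonempty, but needs no search for the producer.
  OnCut : List 𝒯 → 𝒮 → Set
  OnCut done p = (∀ t → 0 < 𝓕ts t p → t ∈ done) × (∀ t → t ∈ done → ¬ 0 < 𝓕st p t)

  Represents : List 𝒯 → Marking N → Set
  Represents done M = ∀ s → HasCard (λ p → πS p ≡ s × OnCut done p) (M s)

  Represents-initial : Represents [] (Net.M0 N)
  Represents-initial s = HasCard-cong (λ p → mk⇔ to from) (π-init s)
    where
    to : ∀ {p} → πS p ≡ s × 0 < 𝓜0 p → πS p ≡ s × OnCut [] p
    to {p} (πp≡s , marked) =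
      πp≡s , (λ t t→p → ⊥-elim (<-irrefl (sym (init-nonempty p t t→p)) marked)) , λ _ ()
    from : ∀ {p} → πS p ≡ s × OnCut [] p → πS p ≡ s × 0 < 𝓜0 p
    from {p} (πp≡s , unproduced , _) =
      πp≡s , subst (0 <_) (sym (init-empty p λ t → n≤0⇒n≡0 (≮⇒≥ (∉[] ∘ unproduced t)))) 0<1+n

  module _ {done : List 𝒯} {y : 𝒯} (closed : Closed done) (y∉done : y ∉ done) (past : PastIn done y) where

    preplace-OnCut : ∀ {p} → 0 < 𝓕st p y → OnCut done p
    preplace-OnCut {p} p→y =
      (λ t t→p → past t (⇀⇒≺ (p , t→p , p→y))) ,
      (λ t t∈done p→t → y∉done (subst (_∈ done) (post-unique p t y p→t p→y) t∈done))

    Remaining Postplace : Net.S N → 𝒮 → Set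
    Remaining s p = (πS p ≡ s × OnCut done p) × ¬ 0 < 𝓕st p y
    Postplace s p = πS p ≡ s × 0 < 𝓕ts y p

    OnCut-∷⇔ : ∀ s p → (Remaining s p ⊎ Postplace s p) ⇔ (πS p ≡ s × OnCut (y ∷ done) p)
    OnCut-∷⇔ s p = mk⇔ to from
      where
      to : Remaining s p ⊎ Postplace s p → πS p ≡ s × OnCut (y ∷ done) p
      to (inj₁ ((πp≡s , produced , unconsumed) , p↛y)) =
        πp≡s ,
        (λ t t→p → there (produced t t→p)) ,
        λ { t (here refl) → p↛y ; t (there t∈done) → unconsumed t t∈done }
      to (inj₂ (πp≡s , y→p)) =
        πp≡s ,
        (λ t t→p → here (pre-unique p t y t→p y→p)) ,
        λ { t (here refl) p→y → acyclic (inj₂ y) (⇀⇒≺ (p , y→p , p→y))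
          ; t (there t∈done) p→t → y∉done (closed t t∈done y (⇀⇒≺ (p , y→p , p→t))) }
      from : πS p ≡ s × OnCut (y ∷ done) p → Remaining s p ⊎ Postplace s p
      from (πp≡s , produced , unconsumed) with 0 <? 𝓕ts y p
      ... | yes y→p = inj₂ (πp≡s , y→p)
      ... | no y↛p = inj₁ ((πp≡s , produced′ , λ t → unconsumed t ∘ there) , unconsumed y (here refl))
        where
        produced′ : ∀ t → 0 < 𝓕ts t p → t ∈ done
        produced′ t t→p with produced t t→p
        ... | here refl = ⊥-elim (y↛p t→p)
        ... | there t∈done = t∈done

    consume : ∀ {M} → Represents done M → ∀ s → Net.Fst N s (πT y) ≤ M s ×
              HasCard (Remaining s) (M s ∸ Net.Fst N s (πT y))
    consume rep s = HasCard-∖ (λ p → 0 <? 𝓕st p y) (rep s)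
      (HasCard-cong (λ p → mk⇔ (λ (πp≡s , p→y) → (πp≡s , preplace-OnCut p→y) , p→y)
                               (λ ((πp≡s , _) , p→y) → πp≡s , p→y))
                    (π-pre y s))

    fire-step : ∀ {M} → Represents done M →
                (∀ s → Net.Fst N s (πT y) ≤ M s) ×
                Represents (y ∷ done) (λ s → (M s ∸ Net.Fst N s (πT y)) + Net.Fts N (πT y) s)
    fire-step rep =
      proj₁ ∘ consume rep ,
      λ s → HasCard-cong (OnCut-∷⇔ s) (HasCard-⊎ (proj₂ (consume rep s)) (π-post y s) Remaining⇒¬Postplace)
      where
      Remaining⇒¬Postplace : ∀ {s} p → Remaining s p → ¬ Postplace s p
      Remaining⇒¬Postplace p ((_ , produced , _) , _) (_ , y→p) = y∉done (produced y y→p)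

  fire : ∀ {done M} ys → Represents done M → Closed done → CausallyOrdered done ys → Fires N M (map πT ys)
  fire [] _ _ _ = tt
  fire (y ∷ ys) rep closed (y∉done , past , ord) =
    _ , (proj₁ (fire-step closed y∉done past rep) , λ _ → refl) ,
    fire ys (proj₂ (fire-step closed y∉done past rep)) (Closed-∷ closed past) ord

  linearization : ∀ xs → CausallyOrdered [] xs → (∀ t → t ∈ xs) → Lin P (map πT xs)
  linearization xs ord covers =
    fire xs Represents-initial (λ _ ()) ord , pos , (pos-injective , pos-surjective) , π-pos , pos-monotone
    where
    open ≡-Reasoning
    xs-unique : Unique xs
    xs-unique = CausallyOrdered⇒Unique xs ord
    idx : 𝒯 → Fin (length xs)
    idx t = index (covers t)
    idx-lookup : ∀ t → t ≡ lookup xs (idx t)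
    idx-lookup t = lookup-index (covers t)
    idx-unique : ∀ {t} i → lookup xs i ≡ t → idx t ≡ i
    idx-unique {t} i xsᵢ≡t =
      Unique⇒lookup-injective xs-unique (idx t) i (trans (sym (idx-lookup t)) (sym xsᵢ≡t))
    pos : 𝒯 → Fin (length (map πT xs))
    pos t = cast (sym (length-map πT xs)) (idx t)
    toℕ-pos : ∀ t → toℕ (pos t) ≡ toℕ (idx t)
    toℕ-pos t = Finₚ.toℕ-cast (sym (length-map πT xs)) (idx t)
    pos-injective : ∀ {t t′} → pos t ≡ pos t′ → t ≡ t′
    pos-injective {t} {t′} same = begin
      t                    ≡⟨ idx-lookup t ⟩
      lookup xs (idx t)    ≡⟨ cong (lookup xs) (Finₚ.toℕ-injective same-idx) ⟩
      lookup xs (idx t′)   ≡⟨ idx-lookup t′ ⟨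
      t′                   ∎
      where
      same-idx : toℕ (idx t) ≡ toℕ (idx t′)
      same-idx = trans (sym (toℕ-pos t)) (trans (cong toℕ same) (toℕ-pos t′))
    pos-surjective : ∀ k → ∃[ t ] (∀ {t′} → t′ ≡ t → pos t′ ≡ k)
    pos-surjective k = lookup xs i , λ { refl → trans (cong (cast |map|≡) (idx-unique i refl))
                                                      (Finₚ.cast-involutive |map|≡ (sym |map|≡) k) }
      where
      |map|≡ = sym (length-map πT xs)
      i = cast (length-map πT xs) k
    π-pos : ∀ t → πT t ≡ lookup (map πT xs) (pos t)
    π-pos t = trans (cong πT (idx-lookup t)) (sym (lookup-map πT xs (idx t)))
    pos-monotone : ∀ t t′ → t ≺ t′ → toℕ (pos t) < toℕ (pos t′)
    pos-monotone t t′ t≺t′ with CausallyOrdered-lookup xs ord (idx t′) t (subst (t ≺_) (idx-lookup t′) t≺t′)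
    ... | inj₂ (j , j<idx , xsⱼ≡t) =
      subst₂ _<_ (trans (cong toℕ (sym (idx-unique j xsⱼ≡t))) (sym (toℕ-pos t))) (sym (toℕ-pos t′)) j<idx

module Completion {N : Net} (P : Process N) (fin : FiniteProcess P) where
  open Process P
  open Net 𝒩 renaming (T to 𝒯; Fst to 𝓕st; Fts to 𝓕ts)
  open Causality P
  open Enumeration (proj₂ fin)

  n : ℕ
  n = proj₁ fin

  PredecessorOutside : List 𝒯 → 𝒯 → Set
  PredecessorOutside done u = ∃[ t ] (t ∉ done × t ⇀ u)

  predecessor-outside? : ∀ done u → Dec (PredecessorOutside done u)
  predecessor-outside? done u =
    Dec.map′ found missed (any? (λ t → (t ∉? done) ×-dec any? (feeds? t) preplaces) elements)
    where
    preplaces = proj₁ (pre-finite u)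
    feeds? : ∀ t → Decidable (λ p → 0 < 𝓕ts t p × 0 < 𝓕st p u)
    feeds? t p = (0 <? 𝓕ts t p) ×-dec (0 <? 𝓕st p u)
    found : Any _ elements → PredecessorOutside done u
    found some = let t , t∉done , via = satisfied some in t , t∉done , satisfied via
    missed : PredecessorOutside done u → Any _ elements
    missed (t , t∉done , p , t→p , p→u) =
      lose (∈-elements t) (t∉done , lose (proj₂ (pre-finite u) p p→u) (t→p , p→u))

  no-predecessor-outside⇒PastIn : ∀ {done u} → Closed done → ¬ PredecessorOutside done u → PastIn done u
  no-predecessor-outside⇒PastIn {done} {u} closed none = past
    where
    past : PastIn done u
    past t [ () ]
    past t (_∷_ {y = inj₂ _} () _)
    past t (_∷_ {y = inj₁ p} t→p [ p→u ]) with t ∈? done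
    ... | yes t∈done = t∈done
    ... | no t∉done = ⊥-elim (none (t , t∉done , p , t→p , p→u))
    past t (_∷_ {y = inj₁ _} _ (_∷_ {y = inj₁ _} () _))
    past t (_∷_ {y = inj₁ p} t→p (_∷_ {y = inj₂ w} p→w w≺u)) = closed w (past w w≺u) t (⇀⇒≺ (p , t→p , p→w))

  -- Walk backwards along predecessors outside done; the transitions passed are distinct,
  -- so a transition without such a predecessor is reached within n steps.
  minimal-outside : ∀ {done u} → Closed done → u ∉ done → ∃[ y ] (y ∉ done × PastIn done y)
  minimal-outside {done} closed u∉done = descend n [] u∉done (All.[] ∷ Unique.[]) All.[] (m≤m+n n 0)
    where
    descend : ∀ fuel {u} later → u ∉ done → Unique (u ∷ later) → All (u ≺_) later →
              n ≤ fuel + length later → ∃[ y ] (y ∉ done × PastIn done y)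
    descend zero later _ distinct _ bound = ⊥-elim (≤⇒≯ bound (Unique⇒length≤ distinct))
    descend (suc fuel) {u} later u∉done distinct u≺later bound with predecessor-outside? done u
    ... | no none = u , u∉done , no-predecessor-outside⇒PastIn closed none
    ... | yes (t , t∉done , t⇀u) =
      descend fuel (u ∷ later) t∉done (∉⇒Unique-∷ t-new distinct) (t≺u All.∷ All.map (t≺u ⁺++_) u≺later)
              (subst (n ≤_) (sym (+-suc fuel (length later))) bound)
      where
      t≺u : t ≺ u
      t≺u = ⇀⇒≺ t⇀u
      t-new : t ∉ u ∷ later
      t-new (here refl) = acyclic (inj₂ t) t≺u
      t-new (there t∈later) = acyclic (inj₂ t) (t≺u ⁺++ All.lookup u≺later t∈later)

  complete : ∀ k {done} → Unique done → Closed done → n ≤ k + length done →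
             ∃[ ys ] (CausallyOrdered done ys × ∀ t → t ∈ ys ⊎ t ∈ done)
  complete k {done} _ _ _ with all-or-missing done
  complete k {done} _ _ _ | inj₁ all = [] , tt , inj₂ ∘ all
  complete zero {done} distinct _ bound | inj₂ (t , t∉done) =
    ⊥-elim (≤⇒≯ bound (Unique⇒length≤ (∉⇒Unique-∷ t∉done distinct)))
  complete (suc k) {done} distinct closed bound | inj₂ (t , t∉done)
    with y , y∉done , past ← minimal-outside closed t∉done
    with ys , ord , covers ← complete k (∉⇒Unique-∷ y∉done distinct) (Closed-∷ closed past)
                                      (subst (n ≤_) (sym (+-suc k (length done))) bound)
    = y ∷ ys , (y∉done , past , ord) , move-y ∘ covers
    where
    move-y : ∀ {u} → u ∈ ys ⊎ u ∈ y ∷ done → u ∈ y ∷ ys ⊎ u ∈ done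
    move-y (inj₁ u∈ys) = inj₁ (there u∈ys)
    move-y (inj₂ (here refl)) = inj₁ (here refl)
    move-y (inj₂ (there u∈done)) = inj₂ u∈done

  extend : ∀ xs → CausallyOrdered [] xs → ∃[ ys ] (CausallyOrdered [] (xs ++ ys) × ∀ t → t ∈ xs ++ ys)
  extend xs ord
    with ys , ord′ , covers ← complete n (CausallyOrdered⇒Unique-ʳ++ xs Unique.[] ord)
                                         (CausallyOrdered⇒Closed xs (λ _ ()) ord) (m≤m+n n _)
    = ys , CausallyOrdered-++ xs ord ord′ , ∈-++ ∘ covers
    where
    ∈-++ : ∀ {t} → t ∈ ys ⊎ t ∈ xs ʳ++ [] → t ∈ xs ++ ys
    ∈-++ (inj₁ t∈ys) = ∈-++⁺ʳ xs t∈ys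
    ∈-++ (inj₂ t∈xs) with inj₂ t∈xs ← reverseAcc⁻ [] xs t∈xs = ∈-++⁺ˡ t∈xs

module Prefix {N : Net} {P″ P′ : Process N} (fin″ : FiniteProcess P″) (P″≤P′ : P″ ≤P P′) where
  open _≤P_ P″≤P′
  module P″ = Process P″
  module P′ = Process P′
  module 𝒩″ = Net P″.𝒩
  module 𝒩′ = Net P′.𝒩
  open Causality P″ using () renaming (_≺_ to _≺″_)
  open Causality P′ using (CausallyOrdered; tabulate-CausallyOrdered) renaming (_≺_ to _≺′_)

  ι : 𝒩″.S ⊎ 𝒩″.T → 𝒩′.S ⊎ 𝒩′.T
  ι = Sum.map ιS ιT

  -- Over each place s of N, ιS injects the preplaces of v into those of ιT v, and both
  -- sets have F(s, π v) elements.
  preplace-in-image : ∀ {p} v → 0 < 𝒩′.Fst p (ιT v) → ∃[ p″ ] (0 < 𝒩″.Fst p″ v × ιS p″ ≡ p)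
  preplace-in-image {p} v p→v =
    let p″ , (_ , p″→v) , ιp″≡p =
          HasCard-injection-onto ιS ιS-inj restrict (P″.π-pre v s) count′ p (refl , p→v)
    in p″ , p″→v , ιp″≡p
    where
    s = P′.πS p
    restrict : ∀ q → P″.πS q ≡ s × 0 < 𝒩″.Fst q v → P′.πS (ιS q) ≡ s × 0 < 𝒩′.Fst (ιS q) (ιT v)
    restrict q (πq≡s , q→v) = trans (sym (πS-eq q)) πq≡s , subst (0 <_) (Fst-eq q v) q→v
    count′ : HasCard (λ q → P′.πS q ≡ s × 0 < 𝒩′.Fst q (ιT v)) (Net.Fst N s (P″.πT v))
    count′ = subst (HasCard _) (cong (Net.Fst N s) (sym (πT-eq v))) (P′.π-pre (ιT v) s)

  -- A place of P″ without producer in P″ is initially marked, hence so is its image,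
  -- which therefore has no producer in P′ either.
  producer-in-image : ∀ {t} q → 0 < 𝒩′.Fts t (ιS q) → ∃[ t″ ] (0 < 𝒩″.Fts t″ q × ιT t″ ≡ t)
  producer-in-image {t} q t→q with any? (λ t″ → 0 <? 𝒩″.Fts t″ q) (Enumeration.elements (proj₂ fin″))
  ... | yes some = let t″ , t″→q = satisfied some in
    t″ , t″→q , P′.pre-unique (ιS q) (ιT t″) t (subst (0 <_) (Fts-eq t″ q) t″→q) t→q
  ... | no none = ⊥-elim (1≢0 (begin
      1                  ≡⟨ P″.init-empty q unproduced ⟨
      𝒩″.M0 q            ≡⟨ init-eq q ⟩
      𝒩′.M0 (ιS q)       ≡⟨ P′.init-nonempty (ιS q) t t→q ⟩
      0                  ∎))
    where
    open ≡-Reasoning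
    1≢0 : 1 ≢ 0
    1≢0 ()
    unproduced : ∀ t″ → 𝒩″.Fts t″ q ≡ 0
    unproduced t″ = n≤0⇒n≡0 (≮⇒≥ λ t″→q → none (lose (Enumeration.∈-elements (proj₂ fin″) t″) t″→q))

  Arc-into-image : ∀ {x} y → Arc P′.𝒩 x (ι y) → ∃[ x″ ] (Arc P″.𝒩 x″ y × ι x″ ≡ x)
  Arc-into-image {inj₁ p} (inj₂ v) p→v =
    let p″ , p″→v , e = preplace-in-image v p→v in inj₁ p″ , p″→v , cong inj₁ e
  Arc-into-image {inj₂ t} (inj₁ q) t→q =
    let t″ , t″→q , e = producer-in-image q t→q in inj₂ t″ , t″→q , cong inj₂ e

  F⁺-into-image : ∀ {x} y → F⁺ P′.𝒩 x (ι y) → ∃[ x″ ] (F⁺ P″.𝒩 x″ y × ι x″ ≡ x)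
  F⁺-into-image y [ x→y ] = let x″ , x″→y , e = Arc-into-image y x→y in x″ , [ x″→y ] , e
  F⁺-into-image y (x→w ∷ w→⁺y) with w″ , w″→⁺y , refl ← F⁺-into-image y w→⁺y =
    let x″ , x″→w″ , e = Arc-into-image w″ x→w in x″ , x″→w″ ∷ w″→⁺y , e

  ≺-into-image : ∀ {t} v → t ≺′ ιT v → ∃[ t″ ] (t″ ≺″ v × ιT t″ ≡ t)
  ≺-into-image v t≺v with F⁺-into-image (inj₂ v) t≺v
  ... | inj₂ t″ , t″≺v , refl = t″ , t″≺v , refl

  image-CausallyOrdered : ∀ σ → Compatible P″ σ → ∃[ xs ] (CausallyOrdered [] xs × map P′.πT xs ≡ σ)
  image-CausallyOrdered σ (pos , (pos-injective , pos-surjective) , π-pos , pos-monotone) =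
    tabulate (ιT ∘ at) , tabulate-CausallyOrdered (ιT ∘ at) at-injective (λ _ ()) before , image↦σ
    where
    open ≡-Reasoning
    at : Fin (length σ) → 𝒩″.T
    at i = proj₁ (pos-surjective i)
    pos-at : ∀ i → pos (at i) ≡ i
    pos-at i = proj₂ (pos-surjective i) refl
    at-injective : ∀ {i j} → ιT (at i) ≡ ιT (at j) → i ≡ j
    at-injective {i} {j} same = trans (sym (pos-at i)) (trans (cong pos (ιT-inj same)) (pos-at j))
    before : ∀ i t → t ≺′ ιT (at i) → t ∈ [] ⊎ ∃[ j ] (j Fin.< i × ιT (at j) ≡ t)
    before i t t≺atᵢ with t″ , t″≺atᵢ , refl ← ≺-into-image (at i) t≺atᵢ =
      inj₂ (pos t″ , subst (λ k → toℕ (pos t″) < toℕ k) (pos-at i) (pos-monotone t″ (at i) t″≺atᵢ) ,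
            cong ιT (pos-injective (pos-at (pos t″))))
    image↦σ : map P′.πT (tabulate (ιT ∘ at)) ≡ σ
    image↦σ = begin
      map P′.πT (tabulate (ιT ∘ at))   ≡⟨ map-tabulate (ιT ∘ at) P′.πT ⟩
      tabulate (P′.πT ∘ ιT ∘ at)       ≡⟨ tabulate-cong π-at ⟩
      tabulate (lookup σ)              ≡⟨ tabulate-lookup σ ⟩
      σ                                ∎
      where
      π-at : ∀ i → P′.πT (ιT (at i)) ≡ lookup σ i
      π-at i = begin
        P′.πT (ιT (at i))     ≡⟨ πT-eq (at i) ⟨
        P″.πT (at i)          ≡⟨ π-pos (at i) ⟩
        lookup σ (pos (at i)) ≡⟨ cong (lookup σ) (pos-at i) ⟩
        lookup σ i            ∎

lemma5 : (N : Net) (P'' P' : Process N) →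
         FiniteProcess P'' → FiniteProcess P' → P'' ≤P P' →
         (σ'' : List (Net.T N)) → Lin P'' σ'' →
         ∃[ σ₀ ] (Lin P' σ₀ × σ'' ⊑ σ₀)
lemma5 N P″ P′ fin″ fin′ P″≤P′ σ″ (_ , compatible)
  with xs , xs-ordered , xs↦σ″ ← Prefix.image-CausallyOrdered fin″ P″≤P′ σ″ compatible
  with ys , ordered , covers ← Completion.extend P′ fin′ xs xs-ordered
  = map πT (xs ++ ys) , Causality.linearization P′ (xs ++ ys) ordered covers , map πT ys , σ″-prefix
  where
  open Process P′ using (πT)
  open ≡-Reasoning
  σ″-prefix : σ″ ++ map πT ys ≡ map πT (xs ++ ys)
  σ″-prefix = begin
    σ″ ++ map πT ys             ≡⟨ cong (_++ map πT ys) xs↦σ″ ⟨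
    map πT xs ++ map πT ys      ≡⟨ map-++ πT xs ys ⟨
    map πT (xs ++ ys)           ∎
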